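{- For all $n \in \mathbb{N}$: (i) $b_n = a_n + n + 5$; (ii) $a_{5F_{n+2}-4} = 5F_{n+3}-4$; (iii) $b_{5F_{n+1}-4} = 5F_{n+3}-3$.
   Context: $F_1=F_2=1$, $F_{i+2}=F_{i+1}+F_i$ is the Fibonacci sequence. Let $\sigma$ be the substitution on finite lists over $\{1,2\}$ acting letterwise by $\sigma(1)=2$, $\sigma(2)=2,1$. Let $C_1=(1,1,1,1,1)$ and $C_{i+1}=\sigma(C_i)$. Let $(c_n)_{n\in\mathbb{N}}$ be the infinite sequence obtained by concatenating $C_1, C_2, C_3, \dots$ in this order (so $c_1,\dots,c_{16}=1,1,1,1,1,2,2,2,2,2,2,1,2,1,2,1$), and let $d_n=c_n+1$. Define $a_1=6$, $a_n = 6+\sum_{i=1}^{n-1} c_i$, and $b_1=12$, $b_n=12+\sum_{i=1}^{n-1} d_i$ for $n\in\mathbb{N}$. -}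

module Defs where

open import Data.Nat using (ℕ; zero; suc; _+_; _∸_; _*_)
open import Data.List using (List; []; _∷_; _++_; concatMap; replicate; length)
open import Data.Bool using (Bool; true; false)

F : ℕ → ℕ
F zero = 0
F (suc zero) = 1
F (suc (suc i)) = F (suc i) + F i

-- the substitution σ on letters 1,2 (letters represented by the naturals 1 and 2)
σ₁ : ℕ → List ℕ
σ₁ 2 = 2 ∷ 1 ∷ []
σ₁ _ = 2 ∷ []

σ : List ℕ → List ℕ
σ = concatMap σ₁

-- C i, for i ≥ 1; C 1 = (1,1,1,1,1), C (i+1) = σ (C i).  (C 0 is set equal to C 1, unused)
C : ℕ → List ℕ
C zero = replicate 5 1
C (suc zero) = replicate 5 1
C (suc (suc i)) = σ (C (suc i))

prefix : ℕ → List ℕ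
prefix zero = []
prefix (suc k) = prefix k ++ C (suc k)

-- 1-indexed lookup, default 0 out of range
nth : List ℕ → ℕ → ℕ
nth [] _ = 0
nth (x ∷ xs) zero = 0
nth (x ∷ xs) (suc zero) = x
nth (x ∷ xs) (suc (suc k)) = nth xs (suc k)

-- c n for n ≥ 1: the n-th entry of C 1 C 2 C 3 ...
-- (prefix n has length ≥ 5n ≥ n since each C i is nonempty of length ≥ 5)
c : ℕ → ℕ
c n = nth (prefix n) n

d : ℕ → ℕ
d n = c n + 1

sumTo : (ℕ → ℕ) → ℕ → ℕ
sumTo f zero = 0
sumTo f (suc m) = sumTo f m + f (suc m)

a : ℕ → ℕ
a n = 6 + sumTo c (n ∸ 1)

b : ℕ → ℕ
b n = 12 + sumTo d (n ∸ 1)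

{-# OPTIONS --safe #-}
module Submission where

-- Over the alphabet {1,2}, σ turns the sum of a word into its length and the
-- sum plus the length into its sum; hence C k has length 5 F k and sum
-- 5 F (k+1), and the prefix C 1 ⋯ C k of c has length 5 F (k+2) − 5 and sum
-- 5 F (k+3) − 10. Since c begins with every such prefix, a at position
-- 5 F (k+2) − 4 is 6 plus that sum, which gives (ii); (i) is immediate from
-- d = c + 1, and (iii) follows from (i) and (ii).

open import Defs
open import Data.Nat using (ℕ; suc; _+_; _∸_; _*_; _≤_)
open import Data.Product using (_×_)
open import Relation.Binary.PropositionalEquality using (_≡_)

open import Data.Nat using (zero; _<_; _≤′_; ≤′-refl; ≤′-step; z≤n; s≤s)
open import Data.Nat.Properties
open import Data.Nat.Tactic.RingSolver using (solve-∀)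
open import Data.List using (List; []; _∷_; _++_; length)
open import Data.List.Properties using (length-++; ++-assoc; ++-identityʳ)
open import Data.Nat.ListAction using (sum)
open import Data.Nat.ListAction.Properties using (sum-++)
open import Data.Product using (_,_; ∃-syntax)
open import Data.Sum using (inj₁; inj₂)
open import Relation.Binary.PropositionalEquality using (refl; sym; trans; cong; cong₂; module ≡-Reasoning)

nth-++ˡ : ∀ xs ys {i} → i ≤ length xs → nth (xs ++ ys) i ≡ nth xs i
nth-++ˡ []       []       z≤n = refl
nth-++ˡ []       (y ∷ ys) z≤n = refl
nth-++ˡ (x ∷ xs) ys {zero}          _       = refl
nth-++ˡ (x ∷ xs) ys {suc zero}      _       = refl
nth-++ˡ (x ∷ xs) ys {suc (suc i)} (s≤s i≤) = nth-++ˡ xs ys i≤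

sumTo-cong : ∀ {f g} m → (∀ {i} → i < m → f (suc i) ≡ g (suc i)) → sumTo f m ≡ sumTo g m
sumTo-cong zero    f≗g = refl
sumTo-cong (suc m) f≗g = cong₂ _+_ (sumTo-cong m (λ i<m → f≗g (m<n⇒m<1+n i<m))) (f≗g ≤-refl)

sumTo-suc : ∀ f m → sumTo f (suc m) ≡ f 1 + sumTo (λ i → f (suc i)) m
sumTo-suc f zero    = +-comm 0 (f 1)
sumTo-suc f (suc m) = trans (cong (_+ f (2 + m)) (sumTo-suc f m)) (+-assoc (f 1) _ _)

sumTo-nth : ∀ xs → sumTo (nth xs) (length xs) ≡ sum xs
sumTo-nth []       = refl
sumTo-nth (x ∷ xs) = begin
  sumTo (nth (x ∷ xs)) (suc (length xs))             ≡⟨ sumTo-suc (nth (x ∷ xs)) (length xs) ⟩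
  x + sumTo (λ i → nth (x ∷ xs) (suc i)) (length xs) ≡⟨ cong (x +_) (sumTo-cong (length xs) (λ _ → refl)) ⟩
  x + sumTo (nth xs) (length xs)                     ≡⟨ cong (x +_) (sumTo-nth xs) ⟩
  x + sum xs                                         ∎
  where open ≡-Reasoning

data Word₁₂ : List ℕ → Set where
  []  : Word₁₂ []
  1∷_ : ∀ {xs} → Word₁₂ xs → Word₁₂ (1 ∷ xs)
  2∷_ : ∀ {xs} → Word₁₂ xs → Word₁₂ (2 ∷ xs)

σ-Word₁₂ : ∀ {xs} → Word₁₂ xs → Word₁₂ (σ xs)
σ-Word₁₂ []      = []
σ-Word₁₂ (1∷ w) = 2∷ σ-Word₁₂ w
σ-Word₁₂ (2∷ w) = 2∷ 1∷ σ-Word₁₂ w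

length-σ : ∀ {xs} → Word₁₂ xs → length (σ xs) ≡ sum xs
length-σ []      = refl
length-σ (1∷ w) = cong suc (length-σ w)
length-σ (2∷ w) = cong (2 +_) (length-σ w)

sum-σ     : ∀ {xs} → Word₁₂ xs → sum (σ xs) ≡ sum xs + length xs
suc-sum-σ : ∀ {xs} → Word₁₂ xs → suc (sum (σ xs)) ≡ sum xs + suc (length xs)

sum-σ []      = refl
sum-σ (1∷ w) = cong suc (suc-sum-σ w)
sum-σ (2∷ w) = cong (2 +_) (suc-sum-σ w)

suc-sum-σ {xs} w = trans (cong suc (sum-σ w)) (sym (+-suc (sum xs) (length xs)))

C-Word₁₂ : ∀ k → Word₁₂ (C (suc k))
C-Word₁₂ zero    = 1∷ 1∷ 1∷ 1∷ 1∷ []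
C-Word₁₂ (suc k) = σ-Word₁₂ (C-Word₁₂ k)

length-C : ∀ k → length (C (suc k)) ≡ 5 * F (suc k)
sum-C    : ∀ k → sum (C (suc k)) ≡ 5 * F (2 + k)

length-C zero    = refl
length-C (suc k) = trans (length-σ (C-Word₁₂ k)) (sum-C k)

sum-C zero    = refl
sum-C (suc k) = begin
  sum (σ (C (suc k)))                      ≡⟨ sum-σ (C-Word₁₂ k) ⟩
  sum (C (suc k)) + length (C (suc k))     ≡⟨ cong₂ _+_ (sum-C k) (length-C k) ⟩
  5 * F (2 + k) + 5 * F (suc k)            ≡⟨ *-distribˡ-+ 5 (F (2 + k)) (F (suc k)) ⟨
  5 * F (3 + k)                            ∎
  where open ≡-Reasoning

-- Stated without subtraction so that, after rewriting with it, 5 * F (2 + k) ∸ 4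
-- computes to suc (length (prefix k)); likewise for sum-prefix.
length-prefix : ∀ k → 5 * F (2 + k) ≡ 5 + length (prefix k)
length-prefix zero    = refl
length-prefix (suc k) = begin
  5 * F (3 + k)                                 ≡⟨ *-distribˡ-+ 5 (F (2 + k)) (F (suc k)) ⟩
  5 * F (2 + k) + 5 * F (suc k)                 ≡⟨ cong₂ _+_ (length-prefix k) (sym (length-C k)) ⟩
  5 + length (prefix k) + length (C (suc k))    ≡⟨ cong (5 +_) (length-++ (prefix k)) ⟨
  5 + length (prefix (suc k))                   ∎
  where open ≡-Reasoning

sum-prefix : ∀ k → 5 * F (3 + k) ≡ 10 + sum (prefix k)
sum-prefix zero    = refl
sum-prefix (suc k) = begin
  5 * F (4 + k)                              ≡⟨ *-distribˡ-+ 5 (F (3 + k)) (F (2 + k)) ⟩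
  5 * F (3 + k) + 5 * F (2 + k)              ≡⟨ cong₂ _+_ (sum-prefix k) (sym (sum-C k)) ⟩
  10 + sum (prefix k) + sum (C (suc k))      ≡⟨ cong (10 +_) (sum-++ (prefix k) (C (suc k))) ⟨
  10 + sum (prefix (suc k))                  ∎
  where open ≡-Reasoning

F-suc-pos : ∀ k → 0 < F (suc k)
F-suc-pos zero    = s≤s z≤n
F-suc-pos (suc k) = ≤-trans (F-suc-pos k) (m≤m+n (F (suc k)) (F k))

≤-length-prefix : ∀ k → k ≤ length (prefix k)
≤-length-prefix zero    = z≤n
≤-length-prefix (suc k) = begin
  suc k                                         ≡⟨ +-comm 1 k ⟩
  k + 1                                         ≤⟨ +-mono-≤ (≤-length-prefix k) (≤-trans (F-suc-pos k) (m≤n*m (F (suc k)) 5)) ⟩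
  length (prefix k) + 5 * F (suc k)             ≡⟨ cong (length (prefix k) +_) (length-C k) ⟨
  length (prefix k) + length (C (suc k))        ≡⟨ length-++ (prefix k) ⟨
  length (prefix (suc k))                       ∎
  where open ≤-Reasoning

prefix-extends : ∀ {k l} → k ≤′ l → ∃[ ys ] prefix l ≡ prefix k ++ ys
prefix-extends {k} ≤′-refl = [] , sym (++-identityʳ (prefix k))
prefix-extends {k} (≤′-step {l} k≤′l) with prefix-extends k≤′l
... | ys , eq = ys ++ C (suc l) , trans (cong (_++ C (suc l)) eq) (++-assoc (prefix k) ys (C (suc l)))

c-prefix : ∀ k {i} → i ≤ length (prefix k) → c i ≡ nth (prefix k) i
c-prefix k {i} i≤ with ≤-total i k
... | inj₁ i≤k with prefix-extends (≤⇒≤′ i≤k)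
...   | ys , eq = sym (trans (cong (λ xs → nth xs i) eq) (nth-++ˡ (prefix i) ys (≤-length-prefix i)))
c-prefix k {i} i≤ | inj₂ k≤i with prefix-extends (≤⇒≤′ k≤i)
...   | ys , eq = trans (cong (λ xs → nth xs i) eq) (nth-++ˡ (prefix k) ys i≤)

sumTo-c-prefix : ∀ k → sumTo c (length (prefix k)) ≡ sum (prefix k)
sumTo-c-prefix k = trans (sumTo-cong (length (prefix k)) (c-prefix k)) (sumTo-nth (prefix k))

sumTo-d : ∀ m → sumTo d m ≡ sumTo c m + m
sumTo-d zero    = refl
sumTo-d (suc m) = begin
  sumTo d m + (c (suc m) + 1)        ≡⟨ cong (_+ (c (suc m) + 1)) (sumTo-d m) ⟩
  sumTo c m + m + (c (suc m) + 1)    ≡⟨ rearrange (sumTo c m) m (c (suc m)) ⟩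
  sumTo c m + c (suc m) + suc m      ∎
  where
  open ≡-Reasoning
  rearrange : ∀ s m x → s + m + (x + 1) ≡ s + x + suc m
  rearrange = solve-∀

b≡a+n+5 : ∀ n → 1 ≤ n → b n ≡ a n + n + 5
b≡a+n+5 (suc m) _ = trans (cong (12 +_) (sumTo-d m)) (rearrange (sumTo c m) m)
  where
  rearrange : ∀ s m → 12 + (s + m) ≡ 6 + s + suc m + 5
  rearrange = solve-∀

a-after-prefix : ∀ k → a (5 * F (2 + k) ∸ 4) ≡ 5 * F (3 + k) ∸ 4
a-after-prefix k rewrite length-prefix k | sum-prefix k = cong (6 +_) (sumTo-c-prefix k)

b-after-prefix : ∀ k → b (5 * F (2 + k) ∸ 4) ≡ 5 * F (4 + k) ∸ 3
b-after-prefix k rewrite *-distribˡ-+ 5 (F (3 + k)) (F (2 + k)) | length-prefix k | sum-prefix k =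
  begin
    b (suc L)                     ≡⟨ b≡a+n+5 (suc L) (s≤s z≤n) ⟩
    6 + sumTo c L + suc L + 5     ≡⟨ cong (λ s → 6 + s + suc L + 5) (sumTo-c-prefix k) ⟩
    6 + S + suc L + 5             ≡⟨ rearrange S L ⟩
    7 + (S + (5 + L))             ∎
  where
  open ≡-Reasoning
  L = length (prefix k)
  S = sum (prefix k)
  rearrange : ∀ s l → 6 + s + suc l + 5 ≡ 7 + (s + (5 + l))
  rearrange = solve-∀

lemma4p2 : (n : ℕ) → 1 ≤ n →
    (b n ≡ a n + n + 5) ×
    (a (5 * F (n + 2) ∸ 4) ≡ 5 * F (n + 3) ∸ 4) ×
    (b (5 * F (n + 1) ∸ 4) ≡ 5 * F (n + 3) ∸ 3)
lemma4p2 n@(suc k) 1≤n rewrite +-comm k 2 | +-comm k 3 | +-comm k 1 =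
  b≡a+n+5 n 1≤n , a-after-prefix n , b-after-prefix k
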